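{- Let $d,R,t\in\mathbb N$ and put $M:=\lfloor dR/t\rfloor$. Then the set $\Delta_d(R)\cap\mathbb Z^d$ can be covered by at most $\binom{M+d}{d}$ translates, by elements of $\mathbb Z^d$, of the set $\Delta_d(t)^\circ\cap\mathbb Z^d$.
   Context: For $\rho\ge0$, $\Delta_d(\rho)=\{(x_1,\dots,x_d)\in\mathbb R_{\ge0}^d:x_1+\cdots+x_d\le\rho\}$, and for $t>0$, $\Delta_d(t)^\circ=\{(x_1,\dots,x_d)\in\mathbb R_{\ge0}^d:x_1+\cdots+x_d<t\}$. $\mathbb N=\{1,2,\dots\}$. -}

module Defs where

open import Data.Nat as ℕ using (ℕ; zero; suc)
open import Data.Fin using (Fin; zero; suc)
open import Data.Integer as ℤ using (ℤ; +_; _-_; _+_; _≤_; _<_)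
open import Data.Product using (_×_)

Point : ℕ → Set
Point d = Fin d → ℤ

sumℤ : ∀ {d} → Point d → ℤ
sumℤ {zero}  x = + 0
sumℤ {suc d} x = x zero + sumℤ (λ i → x (suc i))

_-ᵥ_ : ∀ {d} → Point d → Point d → Point d
(x -ᵥ v) i = x i - v i

InClosedSimplex : ∀ {d} → ℕ → Point d → Set
InClosedSimplex ρ x = (∀ i → + 0 ≤ x i) × sumℤ x ≤ + ρ

InOpenSimplex : ∀ {d} → ℕ → Point d → Set
InOpenSimplex t x = (∀ i → + 0 ≤ x i) × sumℤ x < + t

InTranslate : ∀ {d} → ℕ → Point d → Point d → Set
InTranslate t v x = InOpenSimplex t (x -ᵥ v)

{-# OPTIONS --safe #-}
module Submission where

open import Defs
open import Data.Nat using (ℕ; _*_; _+_; _≤_; _<_; NonZero)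
open import Data.Nat.DivMod using (_/_)
open import Data.Nat.Combinatorics using (_C_)
open import Data.List using (List; length)
open import Data.List.Relation.Unary.Any using (Any)
open import Data.Product using (Σ; _×_)

open import Data.Nat using (zero; suc; pred; _∸_; z≤n; s≤s⁻¹)
open import Data.Nat.Properties
open import Data.Nat.DivMod
  using (_%_; m≡m%n+[m/n]*n; m%n<n; m/n*n≤m; m*n/n≡m; /-monoˡ-≤; m<n*o⇒m/o<n)
open import Data.Nat.Combinatorics using (nCn≡1; nCk+nC[k+1]≡[n+1]C[k+1])
open import Data.Fin using (zero; suc)
open import Data.Vec.Functional using (Vector; []; _∷_; head; tail)
open import Data.Integer as ℤ using (+_; ∣_∣; +≤+; +<+)
open import Data.Integer.Properties using (0≤i⇒+∣i∣≡i; drop‿+≤+; m-n≡m⊖n; ⊖-≥)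
open import Data.List as List using (_++_)
open import Data.List.Properties using (length-++; length-map)
import Data.List.Relation.Unary.Any as Any
open import Data.List.Relation.Unary.Any.Properties using (map⁺; ++⁺ˡ; ++⁺ʳ)
open import Data.Product using (_,_; proj₁; proj₂)
open import Function using (_∘_)
open import Relation.Binary.PropositionalEquality
open import Algebra.Properties.Semiring.Sum +-*-semiring using (sum; *-distribˡ-sum; *-distribʳ-sum)

-- Cut ℝ^d into boxes with sides of length t / d.  A lattice point a of Δ_d(R)
-- lies in the box indexed by k = (⌊d aᵢ / t⌋)ᵢ, and Σ kᵢ ≤ ⌊d R / t⌋ = M, so only
-- the C(M + d, d) lattice points k of Δ_d(M) occur.  Translating Δ_d(t)° to the
-- least lattice point (⌈kᵢ t / d⌉)ᵢ of box k covers the whole box, since each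
-- coordinate of a exceeds that corner by less than t / d.

sum-mono-≤ : ∀ {n} {f g : Vector ℕ n} → (∀ i → f i ≤ g i) → sum f ≤ sum g
sum-mono-≤ {zero}  f≤g = z≤n
sum-mono-≤ {suc n} f≤g = +-mono-≤ (f≤g zero) (sum-mono-≤ (f≤g ∘ suc))

sum-mono-< : ∀ {n} .{{_ : NonZero n}} {f g : Vector ℕ n} → (∀ i → f i < g i) → sum f < sum g
sum-mono-< {suc n} f<g = +-mono-<-≤ (f<g zero) (sum-mono-≤ (<⇒≤ ∘ f<g ∘ suc))

sum-const : ∀ n c → sum {n} (λ _ → c) ≡ n * c
sum-const zero    c = refl
sum-const (suc n) c = cong (λ s → c + s) (sum-const n c)

f*n<c⇒sum[f]<c : ∀ {n} .{{_ : NonZero n}} (f : Vector ℕ n) {c} →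
                   (∀ i → f i * n < c) → sum f < c
f*n<c⇒sum[f]<c {n} f {c} f*n<c = *-cancelʳ-< n (sum f) c (begin-strict
  sum f * n                ≡⟨ *-distribʳ-sum n f ⟩
  sum (λ i → f i * n)      <⟨ sum-mono-< f*n<c ⟩
  sum {n} (λ _ → c)        ≡⟨ sum-const n c ⟩
  n * c                    ≡⟨ *-comm n c ⟩
  c * n                    ∎)
  where open ≤-Reasoning

incrementHead : ∀ {d} → Vector ℕ (suc d) → Vector ℕ (suc d)
incrementHead v = suc (head v) ∷ tail v

-- The lattice points of Δ_d(M); splitting on whether the first coordinate is 0
-- makes their number satisfy Pascal's rule.
simplexPoints : (d M : ℕ) → List (Vector ℕ d)
simplexPoints zero    M       = List.[ [] ]
simplexPoints (suc d) zero    = List.map (0 ∷_) (simplexPoints d zero)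
simplexPoints (suc d) (suc M) = List.map (0 ∷_) (simplexPoints d (suc M))
                             ++ List.map incrementHead (simplexPoints (suc d) M)

length-simplexPoints : ∀ d M → length (simplexPoints d M) ≡ (M + d) C d
length-simplexPoints zero    M    = refl
length-simplexPoints (suc d) zero = begin
  length (List.map (0 ∷_) (simplexPoints d zero))  ≡⟨ length-map (0 ∷_) (simplexPoints d zero) ⟩
  length (simplexPoints d zero)                    ≡⟨ length-simplexPoints d zero ⟩
  d C d                                            ≡⟨ nCn≡1 d ⟩
  1                                                ≡⟨ nCn≡1 (suc d) ⟨
  suc d C suc d                                    ∎
  where open ≡-Reasoning
length-simplexPoints (suc d) (suc M) = begin
  length (List.map (0 ∷_) zeroHead ++ List.map incrementHead positiveHead)
    ≡⟨ length-++ (List.map (0 ∷_) zeroHead) ⟩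
  length (List.map (0 ∷_) zeroHead) + length (List.map incrementHead positiveHead)
    ≡⟨ cong₂ _+_ (length-map (0 ∷_) zeroHead) (length-map incrementHead positiveHead) ⟩
  length zeroHead + length positiveHead
    ≡⟨ cong₂ _+_ (length-simplexPoints d (suc M)) (length-simplexPoints (suc d) M) ⟩
  (suc M + d) C d + (M + suc d) C suc d
    ≡⟨ cong (λ m → (suc M + d) C d + m C suc d) (+-suc M d) ⟩
  (suc M + d) C d + (suc M + d) C suc d
    ≡⟨ nCk+nC[k+1]≡[n+1]C[k+1] (suc M + d) d ⟩
  suc (suc M + d) C suc d
    ≡⟨ cong (λ m → suc m C suc d) (+-suc M d) ⟨
  (suc M + suc d) C suc d
    ∎
  where
  open ≡-Reasoning
  zeroHead = simplexPoints d (suc M)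
  positiveHead = simplexPoints (suc d) M

0∷-≗ : ∀ {d} {v : Vector ℕ (suc d)} {w} → v zero ≡ 0 → w ≗ tail v → (0 ∷ w) ≗ v
0∷-≗ v₀≡0 w≗ zero    = sym v₀≡0
0∷-≗ v₀≡0 w≗ (suc i) = w≗ i

incrementHead-≗ : ∀ {d j} {v : Vector ℕ (suc d)} {w} →
                  v zero ≡ suc j → w ≗ (j ∷ tail v) → incrementHead w ≗ v
incrementHead-≗ v₀≡ w≗ zero    = trans (cong suc (w≗ zero)) (sym v₀≡)
incrementHead-≗ v₀≡ w≗ (suc i) = w≗ (suc i)

simplexPoints-complete : ∀ {d M} (v : Vector ℕ d) → sum v ≤ M → Any (_≗ v) (simplexPoints d M)
simplexPoints-complete {zero} v _ = Any.here (λ ())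
simplexPoints-complete {suc d} {zero} v sum≤0 with v zero in v₀≡
... | zero = map⁺ (Any.map (0∷-≗ v₀≡) (simplexPoints-complete (tail v) sum≤0))
simplexPoints-complete {suc d} {suc M} v sum≤M with v zero in v₀≡
... | zero  = ++⁺ˡ (map⁺ (Any.map (0∷-≗ v₀≡) (simplexPoints-complete (tail v) sum≤M)))
... | suc j = ++⁺ʳ _ (map⁺ (Any.map (incrementHead-≗ v₀≡)
                                   (simplexPoints-complete (j ∷ tail v) (s≤s⁻¹ sum≤M))))

m*n≤o⇒m≤o/n : ∀ m n o .{{_ : NonZero n}} → m * n ≤ o → m ≤ o / n
m*n≤o⇒m≤o/n m n o m*n≤o = begin
  m          ≡⟨ m*n/n≡m m n ⟨
  m * n / n  ≤⟨ /-monoˡ-≤ n m*n≤o ⟩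
  o / n      ∎
  where open ≤-Reasoning

⌈_/_⌉ : (m n : ℕ) .{{_ : NonZero n}} → ℕ
⌈ m / n ⌉ = (m + pred n) / n

m≤⌈m/n⌉*n : ∀ m n .{{_ : NonZero n}} → m ≤ ⌈ m / n ⌉ * n
m≤⌈m/n⌉*n m n = +-cancelʳ-≤ (pred n) m (⌈ m / n ⌉ * n) (begin
  m + pred n                        ≡⟨ m≡m%n+[m/n]*n (m + pred n) n ⟩
  (m + pred n) % n + ⌈ m / n ⌉ * n  ≤⟨ +-monoˡ-≤ _ (suc[m]≤n⇒m≤pred[n] (m%n<n (m + pred n) n)) ⟩
  pred n + ⌈ m / n ⌉ * n            ≡⟨ +-comm (pred n) _ ⟩
  ⌈ m / n ⌉ * n + pred n            ∎)
  where open ≤-Reasoning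

m≤o*n⇒⌈m/n⌉≤o : ∀ m n o .{{_ : NonZero n}} → m ≤ o * n → ⌈ m / n ⌉ ≤ o
m≤o*n⇒⌈m/n⌉≤o m n o m≤o*n = s≤s⁻¹ (m<n*o⇒m/o<n (begin-strict
  m + pred n  <⟨ +-mono-≤-< m≤o*n (m≤pred[n]⇒suc[m]≤n ≤-refl) ⟩
  o * n + n   ≡⟨ +-comm (o * n) n ⟩
  suc o * n   ∎))
  where open ≤-Reasoning

-- The integers a in the slab [k t / n, (k + 1) t / n) are those with
-- slab a ≡ k, and slabStart k is the least of them.
module Slabs (n t : ℕ) .{{_ : NonZero n}} .{{_ : NonZero t}} where

  slab : ℕ → ℕ
  slab a = n * a / t

  slabStart : ℕ → ℕ
  slabStart k = ⌈ k * t / n ⌉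

  slab*t≤n*a : ∀ a → slab a * t ≤ n * a
  slab*t≤n*a a = m/n*n≤m (n * a) t

  n*a<t+slab*t : ∀ a → n * a < t + slab a * t
  n*a<t+slab*t a = begin-strict
    n * a                        ≡⟨ m≡m%n+[m/n]*n (n * a) t ⟩
    (n * a) % t + slab a * t     <⟨ +-monoˡ-< (slab a * t) (m%n<n (n * a) t) ⟩
    t + slab a * t               ∎
    where open ≤-Reasoning

  slabStart-slab≤ : ∀ a → slabStart (slab a) ≤ a
  slabStart-slab≤ a = m≤o*n⇒⌈m/n⌉≤o (slab a * t) n a
    (≤-trans (slab*t≤n*a a) (≤-reflexive (*-comm n a)))

  [a∸slabStart-slab]*n<t : ∀ a → (a ∸ slabStart (slab a)) * n < t
  [a∸slabStart-slab]*n<t a = begin-strict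
    (a ∸ s) * n    ≡⟨ *-distribʳ-∸ n a s ⟩
    a * n ∸ s * n  <⟨ m<n+o⇒m∸n<o (a * n) (s * n) a*n<s*n+t ⟩
    t              ∎
    where
    open ≤-Reasoning
    s = slabStart (slab a)
    a*n<s*n+t : a * n < s * n + t
    a*n<s*n+t = begin-strict
      a * n           ≡⟨ *-comm a n ⟩
      n * a           <⟨ n*a<t+slab*t a ⟩
      t + slab a * t  ≤⟨ +-monoʳ-≤ t (m≤⌈m/n⌉*n (slab a * t) n) ⟩
      t + s * n       ≡⟨ +-comm t (s * n) ⟩
      s * n + t       ∎

  sum-slab≤ : ∀ {m R} (a : Vector ℕ m) → sum a ≤ R → sum (slab ∘ a) ≤ n * R / t
  sum-slab≤ {R = R} a sum≤R = m*n≤o⇒m≤o/n (sum (slab ∘ a)) t (n * R) (begin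
    sum (slab ∘ a) * t          ≡⟨ *-distribʳ-sum t (slab ∘ a) ⟩
    sum (λ i → slab (a i) * t)  ≤⟨ sum-mono-≤ (slab*t≤n*a ∘ a) ⟩
    sum (λ i → n * a i)         ≡⟨ *-distribˡ-sum n a ⟨
    n * sum a                   ≤⟨ *-monoʳ-≤ n sum≤R ⟩
    n * R                       ∎)
    where open ≤-Reasoning

  sum[a∸slabStart-slab]<t : (a : Vector ℕ n) → sum (λ i → a i ∸ slabStart (slab (a i))) < t
  sum[a∸slabStart-slab]<t a = f*n<c⇒sum[f]<c _ ([a∸slabStart-slab]*n<t ∘ a)

sumℤ-cong : ∀ {d} {x y : Point d} → x ≗ y → sumℤ x ≡ sumℤ y
sumℤ-cong {zero}  x≗y = refl
sumℤ-cong {suc d} x≗y = cong₂ ℤ._+_ (x≗y zero) (sumℤ-cong (x≗y ∘ suc))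

sumℤ-+ : ∀ {d} (w : Vector ℕ d) → sumℤ (λ i → + w i) ≡ + sum w
sumℤ-+ {zero}  w = refl
sumℤ-+ {suc d} w = cong (λ s → + w zero ℤ.+ s) (sumℤ-+ (tail w))

InOpenSimplex-ℕ : ∀ {d t} {x : Point d} (w : Vector ℕ d) →
                  x ≗ (λ i → + w i) → sum w < t → InOpenSimplex t x
InOpenSimplex-ℕ {t = t} w x≗w sum<t =
  (λ i → subst (+ 0 ℤ.≤_) (sym (x≗w i)) (+≤+ z≤n)) ,
  subst (ℤ._< + t) (sym (trans (sumℤ-cong x≗w) (sumℤ-+ w))) (+<+ sum<t)

InClosedSimplex⇒ℕ : ∀ {d R} {x : Point d} → InClosedSimplex R x →
                    x ≗ (λ i → + ∣ x i ∣) × sum (λ i → ∣ x i ∣) ≤ R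
InClosedSimplex⇒ℕ {R = R} {x} (x≥0 , sum≤R) =
  x≗∣x∣ , drop‿+≤+ (subst (ℤ._≤ + R) (trans (sumℤ-cong x≗∣x∣) (sumℤ-+ (λ i → ∣ x i ∣))) sum≤R)
  where
  x≗∣x∣ : x ≗ (λ i → + ∣ x i ∣)
  x≗∣x∣ i = sym (0≤i⇒+∣i∣≡i (x≥0 i))

+m-+n≡+[m∸n] : ∀ {m n} → n ≤ m → + m ℤ.- + n ≡ + (m ∸ n)
+m-+n≡+[m∸n] {m} {n} n≤m = trans (m-n≡m⊖n m n) (⊖-≥ n≤m)

lemma2p5 : (d R t : ℕ) → 0 < d → 0 < R → .{{_ : NonZero t}} →
    Σ (List (Point d)) λ vs →
    (length vs ≤ (((d * R) / t) + d) C d) ×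
    ((x : Point d) → InClosedSimplex R x → Any (λ v → InTranslate t v x) vs)
lemma2p5 zero      R t () _
lemma2p5 d@(suc _) R t _  _ = List.map corner (simplexPoints d M) , length≤ , covers
  where
  open Slabs d t
  M = d * R / t

  corner : Vector ℕ d → Point d
  corner k i = + slabStart (k i)

  length≤ : length (List.map corner (simplexPoints d M)) ≤ (M + d) C d
  length≤ = ≤-reflexive (trans (length-map corner (simplexPoints d M)) (length-simplexPoints d M))

  covers : (x : Point d) → InClosedSimplex R x →
           Any (λ v → InTranslate t v x) (List.map corner (simplexPoints d M))
  covers x x∈Δ = map⁺ (Any.map corner-covers (simplexPoints-complete (slab ∘ a) (sum-slab≤ a sum≤R)))
    where
    a : Vector ℕ d
    a i = ∣ x i ∣
    x≗a : x ≗ (λ i → + a i)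
    x≗a = proj₁ (InClosedSimplex⇒ℕ x∈Δ)
    sum≤R : sum a ≤ R
    sum≤R = proj₂ (InClosedSimplex⇒ℕ x∈Δ)
    corner-covers : ∀ {k} → k ≗ (slab ∘ a) → InTranslate t (corner k) x
    corner-covers {k} k≗ = InOpenSimplex-ℕ _ gap (sum[a∸slabStart-slab]<t a)
      where
      gap : ∀ i → x i ℤ.- + slabStart (k i) ≡ + (a i ∸ slabStart (slab (a i)))
      gap i = trans (cong₂ ℤ._-_ (x≗a i) (cong (λ j → + slabStart j) (k≗ i)))
                    (+m-+n≡+[m∸n] (slabStart-slab≤ (a i)))
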